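{- Let $G$ be a connected finite simple graph containing a basic $5$-cycle $C$. Then $\Delta_G$ is shellable if and only if there is a shedding vertex $x\in V(C)$ of $G$ such that $\Delta_{G\setminus x}$ and $\Delta_{G\setminus N_G[x]}$ are shellable.
   Context: A $5$-cycle of $G$ is basic if it does not contain two adjacent vertices of degree at least $3$ in $G$. $\Delta_H$ is the simplicial complex of stable sets of $H$. $G\setminus X$ is the induced subgraph on $V(G)\setminus X$; $N_G[x]$ is the closed neighbourhood. A vertex $x$ is a shedding vertex if no stable set of $G\setminus N_G[x]$ is a maximal stable set of $G\setminus x$. A simplicial complex is shellable if its facets can be ordered $F_1,\dots,F_s$ so that for all $i<j$ there exist $v\in F_j\setminus F_i$ and $l\in\{1,\dots,j-1\}$ with $F_j\setminus F_l=\{v\}$. -}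

module Defs where

open import Data.Nat using (ℕ; _≤_; _<_)
open import Data.Fin using (Fin; toℕ; suc; zero)
open import Data.Fin.Subset using (Subset; _∈_; _∉_; _⊆_; _─_; _-_; _∪_; ⊤; ⁅_⁆; ∣_∣)
open import Data.Bool using (Bool; true; false)
open import Data.Vec using (tabulate)
open import Data.Product using (Σ; ∃; _×_; _,_)
open import Relation.Binary.PropositionalEquality using (_≡_)
open import Relation.Nullary using (¬_)
open import Function.Definitions using (Injective)

record Graph (n : ℕ) : Set where
  field
    adj    : Fin n → Fin n → Bool
    sym    : ∀ x y → adj x y ≡ adj y x
    irrefl : ∀ x → adj x x ≡ false
open Graph public

module _ {n : ℕ} (G : Graph n) where

  N : Fin n → Subset n
  N x = tabulate (adj G x)

  N[_] : Fin n → Subset n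
  N[ x ] = N x ∪ ⁅ x ⁆

  degree : Fin n → ℕ
  degree x = ∣ N x ∣

  data Reach : Fin n → Fin n → Set where
    here : ∀ {x} → Reach x x
    step : ∀ {x y z} → adj G x y ≡ true → Reach y z → Reach x z

  Connected : Set
  Connected = ∀ x y → Reach x y

  next5 : Fin 5 → Fin 5
  next5 zero = suc zero
  next5 (suc zero) = suc (suc zero)
  next5 (suc (suc zero)) = suc (suc (suc zero))
  next5 (suc (suc (suc zero))) = suc (suc (suc (suc zero)))
  next5 (suc (suc (suc (suc zero)))) = zero

  Cycle5 : (Fin 5 → Fin n) → Set
  Cycle5 c = Injective _≡_ _≡_ c × (∀ i → adj G (c i) (c (next5 i)) ≡ true)

  Basic5 : (Fin 5 → Fin n) → Set
  Basic5 c = ∀ i j → adj G (c i) (c j) ≡ true → ¬ (3 ≤ degree (c i) × 3 ≤ degree (c j))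

  -- Stable sets of the induced subgraph G[V] (V a vertex subset),
  -- i.e. the faces of the independence complex Δ_{G[V]}.
  Stable : Subset n → Subset n → Set
  Stable V S = S ⊆ V × (∀ x y → x ∈ S → y ∈ S → adj G x y ≡ false)

  -- maximal stable sets of G[V] = facets of Δ_{G[V]}
  MaximalStable : Subset n → Subset n → Set
  MaximalStable V S = Stable V S × (∀ T → Stable V T → S ⊆ T → T ⊆ S)

  Shellable : Subset n → Set
  Shellable V =
    Σ ℕ λ s → Σ (Fin s → Subset n) λ F →
      Injective _≡_ _≡_ F
      × (∀ i → MaximalStable V (F i))
      × (∀ S → MaximalStable V S → ∃ λ i → F i ≡ S)
      × (∀ (i j : Fin s) → toℕ i < toℕ j →
           ∃ λ v → v ∈ F j × v ∉ F i ×
             ∃ λ (l : Fin s) → toℕ l < toℕ j × (F j ─ F l) ≡ ⁅ v ⁆)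

  Shedding : Fin n → Set
  Shedding x = ∀ S → Stable (⊤ ─ N[ x ]) S → ¬ MaximalStable (⊤ - x) S

-- Write Δ_V for the independence complex of the induced subgraph G[V]. Three operations
-- preserve shellability: passing to the link Δ_{V∖N[x]} (its facets are the facets of Δ_V
-- through x, with x removed), coning over a vertex isolated in G[V], and gluing at a shedding
-- vertex x, where a shelling of Δ_{V∖x} followed by the facets of the link joined with x is a
-- shelling of Δ_V. The last one is the backward implication.
--
-- Conversely, since no two adjacent vertices of the basic cycle x a w d b have degree ≥ 3, we may
-- choose x so that a and b have degree two. A stable set of G∖N[x] that is maximal in G∖x
-- would contain w (or absorb a) and d (or absorb b), although w and d are adjacent; so x is a
-- shedding vertex, and the link of x is shellable as a link of Δ_G. In G∖x the vertex w is
-- shedding for the same reason, Δ_{G∖x∖w} is a cone over a on the link of a in Δ_G, and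
-- Δ_{(G∖x)∖N[w]} is a cone over b on the link of b in the link of w; gluing them at w shows that
-- Δ_{G∖x} is shellable.
module Submission where

open import Defs hiding (sym)
open import Data.Bool using (true; false)
import Data.Bool as Bool
open import Data.Bool.Properties using (¬-not)
open import Data.Nat using (ℕ; zero; suc; _+_; _<_; _≤_; s≤s; _≤?_)
open import Data.Nat.Properties using (<-irrefl; <-asym; <-trans; module ≤-Reasoning)
open import Data.Fin using (Fin; zero; suc; toℕ; fromℕ; inject₁; #_; _≟_)
open import Data.Fin.Properties using (toℕ-fromℕ; toℕ-inject₁; toℕ<n; all?)
open import Data.Fin.Relation.Unary.Top using (View; view; ‵fromℕ; ‵inject₁; view-fromℕ; view-inject₁)
open import Data.Fin.Subset
open import Data.Fin.Subset.Properties
open import Data.List using (List; []; _∷_; length; map; filter; _++_; allFin)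
open import Data.List.Membership.Propositional using () renaming (_∈_ to _∈ₗ_; _∉_ to _∉ₗ_)
open import Data.List.Membership.Propositional.Properties
  using (∈-allFin; ∈-map⁺; ∈-map⁻; ∈-map∘filter⁺; ∈-map∘filter⁻; ∈-++⁺ˡ; ∈-++⁺ʳ; ∈-++⁻)
open import Data.List.Relation.Unary.Any using (here; there)
open import Data.Product using (Σ; ∃; _×_; _,_; proj₁; proj₂)
open import Data.Sum using (_⊎_; inj₁; inj₂; [_,_]′; map₂; swap)
open import Data.Vec using (_∷_; here; there)
open import Data.Vec.Properties using (lookup∘tabulate; []=⇒lookup; lookup⇒[]=)
open import Function using (_∘_)
open import Function.Bundles using (_⇔_; mk⇔)
open import Relation.Binary.PropositionalEquality
open import Relation.Nullary using (¬_; contradiction; yes; no; Dec; _×-dec_; _→-dec_)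
open import Relation.Unary using (Decidable)

private variable
  n : ℕ
  x y z : Fin n
  p q : Subset n

x∈p─q⇒x∉q : ∀ (p q : Subset n) → x ∈ p ─ q → x ∉ q
x∈p─q⇒x∉q (_ ∷ p) (outside ∷ q) here        ()
x∈p─q⇒x∉q (_ ∷ p) (_ ∷ q)       (there x∈p) (there x∈q) = x∈p─q⇒x∉q p q x∈p x∈q

x∈p-y⇒x≢y : ∀ (p : Subset n) → x ∈ p - y → x ≢ y
x∈p-y⇒x≢y {y = y} p x∈p-y = x∉⁅y⁆⇒x≢y (x∈p─q⇒x∉q p ⁅ y ⁆ x∈p-y)

x∉p-x : ∀ (p : Subset n) → x ∉ p - x
x∉p-x p x∈p-x = x∈p-y⇒x≢y p x∈p-x refl

x∈p∪⁅y⁆⁻ : ∀ (p : Subset n) → x ∈ p ∪ ⁅ y ⁆ → x ∈ p ⊎ x ≡ y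
x∈p∪⁅y⁆⁻ {y = y} p x∈ = map₂ (x∈⁅y⁆⇒x≡y y) (x∈p∪q⁻ p ⁅ y ⁆ x∈)

x∉p∪⁅y⁆ : x ∉ p → x ≢ y → x ∉ p ∪ ⁅ y ⁆
x∉p∪⁅y⁆ {p = p} x∉p x≢y x∈ = [ x∉p , x≢y ]′ (x∈p∪⁅y⁆⁻ p x∈)

p─q≡⁅y⁆⇒x∈q : p ─ q ≡ ⁅ y ⁆ → x ∈ p → x ≢ y → x ∈ q
p─q≡⁅y⁆⇒x∈q {q = q} {y = y} {x = x} eq x∈p x≢y with x ∈? q
... | yes x∈q = x∈q
... | no  x∉q = contradiction (x∈⁅y⁆⇒x≡y y (subst (x ∈_) eq (x∈p∧x∉q⇒x∈p─q x∈p x∉q))) x≢y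

p⊆q∧x∉p⇒p⊆q-x : p ⊆ q → x ∉ p → p ⊆ q - x
p⊆q∧x∉p⇒p⊆q-x p⊆q x∉p y∈p = x∈p∧x≢y⇒x∈p-y (p⊆q y∈p) λ { refl → x∉p y∈p }

p-x⊆q⇒p⊆q∪⁅x⁆ : p - x ⊆ q → p ⊆ q ∪ ⁅ x ⁆
p-x⊆q⇒p⊆q∪⁅x⁆ {x = x} p-x⊆q {y} y∈p with y ≟ x
... | yes refl = q⊆p∪q _ _ (x∈⁅x⁆ x)
... | no  y≢x  = p⊆p∪q _ (p-x⊆q (x∈p∧x≢y⇒x∈p-y y∈p y≢x))

p⊆r∧x∈r⇒p∪⁅x⁆⊆r : ∀ {r : Subset n} → p ⊆ r → x ∈ r → p ∪ ⁅ x ⁆ ⊆ r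
p⊆r∧x∈r⇒p∪⁅x⁆⊆r {p = p} p⊆r x∈r y∈ with x∈p∪⁅y⁆⁻ p y∈
... | inj₁ y∈p  = p⊆r y∈p
... | inj₂ refl = x∈r

x∉p⇒∣p∣<∣p∪⁅x⁆∣ : x ∉ p → ∣ p ∣ < ∣ p ∪ ⁅ x ⁆ ∣
x∉p⇒∣p∣<∣p∪⁅x⁆∣ {x = x} {p = p} x∉p = p⊂q⇒∣p∣<∣q∣ (p⊆p∪q _ , x , q⊆p∪q p _ (x∈⁅x⁆ x) , x∉p)

three-elements⇒3≤∣p∣ : ∀ {n} {p : Subset n} {x y z} →
                       x ∈ p → y ∈ p → z ∈ p → y ≢ x → z ≢ x → z ≢ y → 3 ≤ ∣ p ∣
three-elements⇒3≤∣p∣ {n} {p} {x} {y} {z} x∈p y∈p z∈p y≢x z≢x z≢y = begin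
  3                                  ≡⟨ cong (3 +_) (∣⊥∣≡0 n) ⟨
  3 + ∣ ⊥ {n} ∣                      ≤⟨ s≤s (s≤s (x∉p⇒∣p∣<∣p∪⁅x⁆∣ {p = ⊥ {n}} ∉⊥)) ⟩
  2 + ∣ ⊥ ∪ ⁅ x ⁆ ∣                  ≤⟨ s≤s (x∉p⇒∣p∣<∣p∪⁅x⁆∣ (x∉p∪⁅y⁆ ∉⊥ y≢x)) ⟩
  1 + ∣ (⊥ ∪ ⁅ x ⁆) ∪ ⁅ y ⁆ ∣        ≤⟨ x∉p⇒∣p∣<∣p∪⁅x⁆∣ (x∉p∪⁅y⁆ (x∉p∪⁅y⁆ ∉⊥ z≢x) z≢y) ⟩
  ∣ ((⊥ ∪ ⁅ x ⁆) ∪ ⁅ y ⁆) ∪ ⁅ z ⁆ ∣  ≤⟨ p⊆q⇒∣p∣≤∣q∣ (p⊆r∧x∈r⇒p∪⁅x⁆⊆r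
                                          (p⊆r∧x∈r⇒p∪⁅x⁆⊆r (p⊆r∧x∈r⇒p∪⁅x⁆⊆r (⊆-min p) x∈p) y∈p) z∈p) ⟩
  ∣ p ∣                              ∎
  where open ≤-Reasoning

x∈q⇒[p-x]─[q-x]≡p─q : x ∈ q → p - x ─ (q - x) ≡ p ─ q
x∈q⇒[p-x]─[q-x]≡p─q {x = x} {q = q} {p = p} x∈q = ⊆-antisym sub sup
  where
  sub : p - x ─ (q - x) ⊆ p ─ q
  sub y∈ = let y∈p-x = p─q⊆p _ _ y∈ in
    x∈p∧x∉q⇒x∈p─q (p─q⊆p _ _ y∈p-x)
      (λ y∈q → x∈p─q⇒x∉q _ _ y∈ (x∈p∧x≢y⇒x∈p-y y∈q (x∈p-y⇒x≢y p y∈p-x)))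
  sup : p ─ q ⊆ p - x ─ (q - x)
  sup y∈ = x∈p∧x∉q⇒x∈p─q (x∈p∧x≢y⇒x∈p-y (p─q⊆p _ _ y∈) λ { refl → x∈p─q⇒x∉q p q y∈ x∈q })
                         (x∈p─q⇒x∉q p q y∈ ∘ p─q⊆p _ _)

x∈q⇒[p-x]─q≡p─q : x ∈ q → p - x ─ q ≡ p ─ q
x∈q⇒[p-x]─q≡p─q {x = x} {q = q} {p = p} x∈q = ⊆-antisym sub sup
  where
  sub : p - x ─ q ⊆ p ─ q
  sub y∈ = x∈p∧x∉q⇒x∈p─q (p─q⊆p _ _ (p─q⊆p _ _ y∈)) (x∈p─q⇒x∉q _ _ y∈)
  sup : p ─ q ⊆ p - x ─ q
  sup y∈ = x∈p∧x∉q⇒x∈p─q (x∈p∧x≢y⇒x∈p-y (p─q⊆p _ _ y∈) λ { refl → x∈p─q⇒x∉q p q y∈ x∈q })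
                         (x∈p─q⇒x∉q p q y∈)

x∉p⇒[p∪⁅x⁆]─[q∪⁅x⁆]≡p─q : x ∉ p → p ∪ ⁅ x ⁆ ─ (q ∪ ⁅ x ⁆) ≡ p ─ q
x∉p⇒[p∪⁅x⁆]─[q∪⁅x⁆]≡p─q {x = x} {p = p} {q} x∉p = ⊆-antisym sub sup
  where
  sub : p ∪ ⁅ x ⁆ ─ (q ∪ ⁅ x ⁆) ⊆ p ─ q
  sub y∈ with x∈p∪⁅y⁆⁻ p (p─q⊆p _ _ y∈)
  ... | inj₁ y∈p  = x∈p∧x∉q⇒x∈p─q y∈p (x∈p─q⇒x∉q _ _ y∈ ∘ p⊆p∪q _)
  ... | inj₂ refl = contradiction (q⊆p∪q q _ (x∈⁅x⁆ x)) (x∈p─q⇒x∉q _ _ y∈)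
  sup : p ─ q ⊆ p ∪ ⁅ x ⁆ ─ (q ∪ ⁅ x ⁆)
  sup y∈ = let y∈p = p─q⊆p _ _ y∈ in
    x∈p∧x∉q⇒x∈p─q (p⊆p∪q _ y∈p) (x∉p∪⁅y⁆ (x∈p─q⇒x∉q p q y∈) λ { refl → x∉p y∈p })

p⊆q⇒[p∪⁅x⁆]─q≡⁅x⁆ : p ⊆ q → x ∉ q → p ∪ ⁅ x ⁆ ─ q ≡ ⁅ x ⁆
p⊆q⇒[p∪⁅x⁆]─q≡⁅x⁆ {p = p} {q = q} {x = x} p⊆q x∉q = ⊆-antisym sub sup
  where
  sub : p ∪ ⁅ x ⁆ ─ q ⊆ ⁅ x ⁆
  sub y∈ with x∈p∪⁅y⁆⁻ p (p─q⊆p _ _ y∈)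
  ... | inj₁ y∈p  = contradiction (p⊆q y∈p) (x∈p─q⇒x∉q _ _ y∈)
  ... | inj₂ refl = x∈⁅x⁆ x
  sup : ⁅ x ⁆ ⊆ p ∪ ⁅ x ⁆ ─ q
  sup y∈x with refl ← x∈⁅y⁆⇒x≡y x y∈x = x∈p∧x∉q⇒x∈p─q (q⊆p∪q p _ (x∈⁅x⁆ x)) x∉q

x∉p⇒[p∪⁅x⁆]-x≡p : x ∉ p → p ∪ ⁅ x ⁆ - x ≡ p
x∉p⇒[p∪⁅x⁆]-x≡p {x = x} {p = p} x∉p = ⊆-antisym sub sup
  where
  sub : p ∪ ⁅ x ⁆ - x ⊆ p
  sub y∈ with x∈p∪⁅y⁆⁻ p (p─q⊆p _ _ y∈)
  ... | inj₁ y∈p  = y∈p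
  ... | inj₂ refl = contradiction y∈ (x∉p-x _)
  sup : p ⊆ p ∪ ⁅ x ⁆ - x
  sup = p⊆q∧x∉p⇒p⊆q-x (p⊆p∪q _) x∉p

x∈p⇒[p-x]∪⁅x⁆≡p : x ∈ p → (p - x) ∪ ⁅ x ⁆ ≡ p
x∈p⇒[p-x]∪⁅x⁆≡p {x = x} {p = p} x∈p =
  ⊆-antisym (p⊆r∧x∈r⇒p∪⁅x⁆⊆r (p─q⊆p _ _) x∈p) (p-x⊆q⇒p⊆q∪⁅x⁆ λ y∈ → y∈)

-- Shellings as lists of facets

Extends : List (Subset n) → Subset n → Set
Extends P F = ∀ {E} → E ∈ₗ P → ∃ λ v → v ∈ F × v ∉ E × ∃ λ D → D ∈ₗ P × F ─ D ≡ ⁅ v ⁆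

-- The facets are listed latest first.
data IsShelling {n} : List (Subset n) → Set where
  []  : IsShelling []
  _∷_ : ∀ {F P} → Extends P F → IsShelling P → IsShelling (F ∷ P)

Extends⇒∉ : ∀ {P} {F : Subset n} → Extends P F → F ∉ₗ P
Extends⇒∉ extends F∈P with _ , v∈F , v∉F , _ ← extends F∈P = v∉F v∈F

IsShellingOrder : ∀ {s} → (Fin s → Subset n) → Set
IsShellingOrder {s = s} F = ∀ (i j : Fin s) → toℕ i < toℕ j →
  ∃ λ v → v ∈ F j × v ∉ F i × ∃ λ (l : Fin s) → toℕ l < toℕ j × (F j ─ F l) ≡ ⁅ v ⁆

index : (P : List (Subset n)) → Fin (length P) → Subset n
index (F ∷ P) i = atTop (view i)
  where
  atTop : ∀ {i} → View i → Subset _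
  atTop ‵fromℕ       = F
  atTop (‵inject₁ j) = index P j

index-inject₁ : ∀ (F : Subset n) P j → index (F ∷ P) (inject₁ j) ≡ index P j
index-inject₁ F P j rewrite view-inject₁ j = refl

index-fromℕ : ∀ (F : Subset n) P → index (F ∷ P) (fromℕ (length P)) ≡ F
index-fromℕ F P rewrite view-fromℕ (length P) = refl

index-∈ : ∀ (P : List (Subset n)) i → index P i ∈ₗ P
index-∈ (F ∷ P) i with view i
... | ‵fromℕ     = here refl
... | ‵inject₁ j = there (index-∈ P j)

∈⇒index : ∀ {P} {X : Subset n} → X ∈ₗ P → ∃ λ i → index P i ≡ X
∈⇒index {P = F ∷ P} (here refl) = fromℕ (length P) , index-fromℕ F P
∈⇒index {P = F ∷ P} (there X∈P) with i , refl ← ∈⇒index X∈P = inject₁ i , index-inject₁ F P i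

index-injective : ∀ {P : List (Subset n)} → IsShelling P → ∀ {i j} → index P i ≡ index P j → i ≡ j
index-injective {P = F ∷ P} (extends ∷ shelling) {i} {j} eq with view i | view j
... | ‵fromℕ     | ‵fromℕ     = refl
... | ‵fromℕ     | ‵inject₁ j = contradiction (subst (_∈ₗ P) (sym eq) (index-∈ P j)) (Extends⇒∉ extends)
... | ‵inject₁ i | ‵fromℕ     = contradiction (subst (_∈ₗ P) eq (index-∈ P i)) (Extends⇒∉ extends)
... | ‵inject₁ i | ‵inject₁ j = cong inject₁ (index-injective shelling eq)

index-order : ∀ {P : List (Subset n)} → IsShelling P → IsShellingOrder (index P)
index-order {P = F ∷ P} (extends ∷ shelling) i j i<j with view i | view j
... | ‵fromℕ     | ‵fromℕ     = contradiction i<j (<-irrefl refl)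
... | ‵fromℕ     | ‵inject₁ j =
  contradiction i<j (<-asym (subst₂ _<_ (sym (toℕ-inject₁ j)) (sym (toℕ-fromℕ _)) (toℕ<n j)))
... | ‵inject₁ i | ‵inject₁ j
  with v , v∈ , v∉ , l , l<j , eq ← index-order shelling i j (subst₂ _<_ (toℕ-inject₁ i) (toℕ-inject₁ j) i<j)
  = v , v∈ , v∉ , inject₁ l , subst₂ _<_ (sym (toℕ-inject₁ l)) (sym (toℕ-inject₁ j)) l<j ,
    subst (λ D → index P j ─ D ≡ ⁅ v ⁆) (sym (index-inject₁ F P l)) eq
... | ‵inject₁ i | ‵fromℕ
  with v , v∈ , v∉ , D , D∈P , eq ← extends (index-∈ P i)
  with l , refl ← ∈⇒index D∈P
  = v , v∈ , v∉ , inject₁ l , subst₂ _<_ (sym (toℕ-inject₁ l)) (sym (toℕ-fromℕ _)) (toℕ<n l) ,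
    subst (λ D → F ─ D ≡ ⁅ v ⁆) (sym (index-inject₁ F P l)) eq

reverseTabulate : ∀ {s} → (Fin s → Subset n) → List (Subset n)
reverseTabulate {s = zero}  F = []
reverseTabulate {s = suc s} F = F (fromℕ s) ∷ reverseTabulate (F ∘ inject₁)

∈-reverseTabulate⁺ : ∀ {s} (F : Fin s → Subset n) i → F i ∈ₗ reverseTabulate F
∈-reverseTabulate⁺ {s = suc s} F i with view i
... | ‵fromℕ     = here refl
... | ‵inject₁ j = there (∈-reverseTabulate⁺ (F ∘ inject₁) j)

∈-reverseTabulate⁻ : ∀ {s} (F : Fin s → Subset n) {X} → X ∈ₗ reverseTabulate F → ∃ λ i → F i ≡ X
∈-reverseTabulate⁻ {s = suc s} F (here refl) = fromℕ s , refl
∈-reverseTabulate⁻ {s = suc s} F (there X∈)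
  with i , Fi≡X ← ∈-reverseTabulate⁻ (F ∘ inject₁) X∈ = inject₁ i , Fi≡X

toℕ<⇒inject₁ : ∀ {s} (l : Fin (suc s)) → toℕ l < s → ∃ λ l′ → inject₁ l′ ≡ l
toℕ<⇒inject₁ {s = s} l l<s with view l
... | ‵fromℕ      = contradiction (subst (_< s) (toℕ-fromℕ s) l<s) (<-irrefl refl)
... | ‵inject₁ l′ = l′ , refl

IsShellingOrder-inject₁ : ∀ {s} {F : Fin (suc s) → Subset n} →
                          IsShellingOrder F → IsShellingOrder (F ∘ inject₁)
IsShellingOrder-inject₁ {s = s} order i j i<j
  with v , v∈ , v∉ , l , l<j , eq ←
         order (inject₁ i) (inject₁ j) (subst₂ _<_ (sym (toℕ-inject₁ i)) (sym (toℕ-inject₁ j)) i<j)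
  with l′ , refl ← toℕ<⇒inject₁ l (<-trans l<j (subst (_< s) (sym (toℕ-inject₁ j)) (toℕ<n j)))
  = v , v∈ , v∉ , l′ , subst₂ _<_ (toℕ-inject₁ l′) (toℕ-inject₁ j) l<j , eq

reverseTabulate-shelling : ∀ {s} {F : Fin s → Subset n} → IsShellingOrder F → IsShelling (reverseTabulate F)
reverseTabulate-shelling {s = zero}          order = []
reverseTabulate-shelling {s = suc s} {F = F} order =
  extends ∷ reverseTabulate-shelling (IsShellingOrder-inject₁ order)
  where
  extends : Extends (reverseTabulate (F ∘ inject₁)) (F (fromℕ s))
  extends E∈
    with i , refl ← ∈-reverseTabulate⁻ (F ∘ inject₁) E∈
    with v , v∈ , v∉ , l , l<s , eq ←
           order (inject₁ i) (fromℕ s) (subst₂ _<_ (sym (toℕ-inject₁ i)) (sym (toℕ-fromℕ s)) (toℕ<n i))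
    with l′ , refl ← toℕ<⇒inject₁ {s = s} l (subst (toℕ l <_) (toℕ-fromℕ s) l<s)
    = v , v∈ , v∉ , F (inject₁ l′) , ∈-reverseTabulate⁺ (F ∘ inject₁) l′ , eq

Extends-∪⁅⁆ : ∀ {P} {F : Subset n} {x} → x ∉ F → Extends P F → Extends (map (_∪ ⁅ x ⁆) P) (F ∪ ⁅ x ⁆)
Extends-∪⁅⁆ {x = x} x∉F extends E∪x∈
  with E , E∈P , refl ← ∈-map⁻ (_∪ ⁅ x ⁆) E∪x∈
  with v , v∈F , v∉E , D , D∈P , eq ← extends E∈P
  = v , p⊆p∪q _ v∈F , x∉p∪⁅y⁆ v∉E (λ { refl → x∉F v∈F }) ,
    D ∪ ⁅ x ⁆ , ∈-map⁺ (_∪ ⁅ x ⁆) D∈P , trans (x∉p⇒[p∪⁅x⁆]─[q∪⁅x⁆]≡p─q x∉F) eq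

IsShelling-∪⁅⁆ : ∀ {P} {x : Fin n} → (∀ {F} → F ∈ₗ P → x ∉ F) → IsShelling P → IsShelling (map (_∪ ⁅ x ⁆) P)
IsShelling-∪⁅⁆ x∉ []                   = []
IsShelling-∪⁅⁆ x∉ (extends ∷ shelling) =
  Extends-∪⁅⁆ (x∉ (here refl)) extends ∷ IsShelling-∪⁅⁆ (x∉ ∘ there) shelling

link : Fin n → List (Subset n) → List (Subset n)
link x P = map (_- x) (filter (x ∈?_) P)

Extends-link : ∀ {P} {F : Subset n} {x} → x ∈ F → Extends P F → Extends (link x P) (F - x)
Extends-link {x = x} x∈F extends E-x∈
  with E , E∈P , refl , x∈E ← ∈-map∘filter⁻ (_- x) (x ∈?_) E-x∈
  with v , v∈F , v∉E , D , D∈P , eq ← extends E∈P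
  = v , x∈p∧x≢y⇒x∈p-y v∈F v≢x , v∉E ∘ p─q⊆p E ⁅ x ⁆ ,
    D - x , ∈-map∘filter⁺ (_- x) (x ∈?_) (D , D∈P , refl , x∈D) , trans (x∈q⇒[p-x]─[q-x]≡p─q x∈D) eq
  where
  v≢x : v ≢ x
  v≢x refl = v∉E x∈E
  x∈D : x ∈ D
  x∈D = p─q≡⁅y⁆⇒x∈q eq x∈F (v≢x ∘ sym)

IsShelling-link : ∀ {P} (x : Fin n) → IsShelling P → IsShelling (link x P)
IsShelling-link x [] = []
IsShelling-link {P = F ∷ P} x (extends ∷ shelling) with x ∈? F
... | yes x∈F = Extends-link x∈F extends ∷ IsShelling-link x shelling
... | no  _   = IsShelling-link x shelling

IsShelling-cone++ : ∀ {Q P} {x : Fin n} →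
                    (∀ {F} → F ∈ₗ Q → x ∉ F) → (∀ {E} → E ∈ₗ P → x ∉ E) →
                    (∀ {F} → F ∈ₗ Q → ∃ λ D → D ∈ₗ P × F ⊆ D) →
                    IsShelling Q → IsShelling P → IsShelling (map (_∪ ⁅ x ⁆) Q ++ P)
IsShelling-cone++ x∉Q x∉P covered [] shellingP = shellingP
IsShelling-cone++ {Q = F ∷ Q} {P} {x} x∉Q x∉P covered (extends ∷ shellingQ) shellingP =
  extends′ ∷ IsShelling-cone++ (x∉Q ∘ there) x∉P (covered ∘ there) shellingQ shellingP
  where
  extends′ : Extends (map (_∪ ⁅ x ⁆) Q ++ P) (F ∪ ⁅ x ⁆)
  extends′ E∈ with ∈-++⁻ (map (_∪ ⁅ x ⁆) Q) E∈
  ... | inj₁ E∈Q with v , v∈ , v∉ , D , D∈ , eq ← Extends-∪⁅⁆ (x∉Q (here refl)) extends E∈Q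
    = v , v∈ , v∉ , D , ∈-++⁺ˡ D∈ , eq
  ... | inj₂ E∈P with D , D∈P , F⊆D ← covered (here refl)
    = x , q⊆p∪q F _ (x∈⁅x⁆ x) , x∉P E∈P , D , ∈-++⁺ʳ _ D∈P , p⊆q⇒[p∪⁅x⁆]─q≡⁅x⁆ F⊆D (x∉P D∈P)

-- Stable sets of induced subgraphs

module _ {n : ℕ} (G : Graph n) where

  private variable
    V W S T : Subset n

  adj-sym : adj G x y ≡ true → adj G y x ≡ true
  adj-sym {x} {y} xy = trans (Graph.sym G y x) xy

  adj⇒≢ : adj G x y ≡ true → x ≢ y
  adj⇒≢ {x} xy refl = contradiction (trans (sym xy) (irrefl G x)) λ ()

  adj⇒∈N : adj G x y ≡ true → y ∈ N G x
  adj⇒∈N {x} {y} xy = lookup⇒[]= y (N G x) (trans (lookup∘tabulate (adj G x) y) xy)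

  ∈N⇒adj : y ∈ N G x → adj G x y ≡ true
  ∈N⇒adj {y} {x} y∈ = trans (sym (lookup∘tabulate (adj G x) y)) ([]=⇒lookup y∈)

  adj⇒∈N[] : adj G x y ≡ true → y ∈ N[_] G x
  adj⇒∈N[] xy = p⊆p∪q _ (adj⇒∈N xy)

  x∈N[x] : ∀ x → x ∈ N[_] G x
  x∈N[x] x = q⊆p∪q _ _ (x∈⁅x⁆ x)

  ∉N[]⇒nonadj : y ∉ N[_] G x → adj G x y ≡ false
  ∉N[]⇒nonadj y∉ = ¬-not (y∉ ∘ adj⇒∈N[])

  nonadj⇒∉N[] : adj G x y ≡ false → y ≢ x → y ∉ N[_] G x
  nonadj⇒∉N[] {x} {y} x≁y y≢x y∈ with x∈p∪⁅y⁆⁻ (N G x) y∈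
  ... | inj₁ y∈Nx = contradiction (trans (sym (∈N⇒adj y∈Nx)) x≁y) λ ()
  ... | inj₂ y≡x  = y≢x y≡x

  Stable⇒nonadj : Stable G V S → x ∈ S → y ∈ S → adj G x y ≢ true
  Stable⇒nonadj (_ , indep) x∈S y∈S xy = contradiction (trans (sym xy) (indep _ _ x∈S y∈S)) λ ()

  Anticomplete : Fin n → Subset n → Set
  Anticomplete y S = ∀ z → z ∈ S → adj G y z ≡ false

  anticomplete? : ∀ y S → Dec (Anticomplete y S)
  anticomplete? y S = all? λ z → z ∈? S →-dec adj G y z Bool.≟ false

  Stable-mono : V ⊆ W → Stable G V S → Stable G W S
  Stable-mono V⊆W (S⊆V , indep) = V⊆W ∘ S⊆V , indep

  Stable-∪⁅⁆ : Stable G V S → y ∈ V → Anticomplete y S → Stable G V (S ∪ ⁅ y ⁆)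
  Stable-∪⁅⁆ {V} {S} {y} (S⊆V , indep) y∈V y∼S = p⊆r∧x∈r⇒p∪⁅x⁆⊆r S⊆V y∈V , indep′
    where
    indep′ : ∀ a b → a ∈ S ∪ ⁅ y ⁆ → b ∈ S ∪ ⁅ y ⁆ → adj G a b ≡ false
    indep′ a b a∈ b∈ with x∈p∪⁅y⁆⁻ S a∈ | x∈p∪⁅y⁆⁻ S b∈
    ... | inj₁ a∈S | inj₁ b∈S = indep a b a∈S b∈S
    ... | inj₁ a∈S | inj₂ refl = trans (Graph.sym G a y) (y∼S a a∈S)
    ... | inj₂ refl | inj₁ b∈S = y∼S b b∈S
    ... | inj₂ refl | inj₂ refl = irrefl G y

  MaximalStable-absorbs : MaximalStable G V S → y ∈ V → Anticomplete y S → y ∈ S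
  MaximalStable-absorbs {y = y} (stable , maximal) y∈V y∼S =
    maximal _ (Stable-∪⁅⁆ stable y∈V y∼S) (p⊆p∪q _) (q⊆p∪q _ _ (x∈⁅x⁆ y))

  module _ (V : Subset n) where

    Blocked : Subset n → Fin n → Set
    Blocked S y = y ∈ S ⊎ ¬ (y ∈ V × Anticomplete y S)

    Blocked-mono : S ⊆ T → Blocked S y → Blocked T y
    Blocked-mono S⊆T (inj₁ y∈S)   = inj₁ (S⊆T y∈S)
    Blocked-mono S⊆T (inj₂ ¬free) = inj₂ λ (y∈V , y∼T) → ¬free (y∈V , λ z z∈S → y∼T z (S⊆T z∈S))

    block : ∀ y S → Stable G V S → ∃ λ S′ → Stable G V S′ × S ⊆ S′ × Blocked S′ y
    block y S stable with y ∈? V ×-dec anticomplete? y S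
    ... | yes (y∈V , y∼S) = S ∪ ⁅ y ⁆ , Stable-∪⁅⁆ stable y∈V y∼S , p⊆p∪q _ , inj₁ (q⊆p∪q _ _ (x∈⁅x⁆ y))
    ... | no ¬free         = S , stable , (λ y∈S → y∈S) , inj₂ ¬free

    blockAll : ∀ ys S → Stable G V S → ∃ λ M → Stable G V M × S ⊆ M × (∀ {y} → y ∈ₗ ys → Blocked M y)
    blockAll []       S stable = S , stable , (λ y∈S → y∈S) , λ ()
    blockAll (y ∷ ys) S stable
      with S′ , stable′ , S⊆S′ , blocked ← block y S stable
      with M , stableM , S′⊆M , blockedM ← blockAll ys S′ stable′
      = M , stableM , S′⊆M ∘ S⊆S′ , λ { (here refl) → Blocked-mono S′⊆M blocked ; (there y∈) → blockedM y∈ }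

  maximal-extension : Stable G V S → ∃ λ M → MaximalStable G V M × S ⊆ M
  maximal-extension {V} {S} stable with M , stableM , S⊆M , blocked ← blockAll V (allFin n) S stable
    = M , (stableM , maximal) , S⊆M
    where
    maximal : ∀ T → Stable G V T → M ⊆ T → T ⊆ M
    maximal T (T⊆V , indep) M⊆T {y} y∈T with blocked (∈-allFin y)
    ... | inj₁ y∈M   = y∈M
    ... | inj₂ ¬free = contradiction (T⊆V y∈T , λ z z∈M → indep y z y∈T (M⊆T z∈M)) ¬free

  SheddingIn : Subset n → Fin n → Set
  SheddingIn V x = ∀ S → Stable G (V ─ N[_] G x) S → ¬ MaximalStable G (V - x) S

  x∉link : Stable G (V ─ N[_] G x) T → x ∉ T
  x∉link (T⊆ , _) x∈T = x∈p─q⇒x∉q _ _ (T⊆ x∈T) (x∈N[x] _)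

  Stable-link⇒Stable : x ∈ V → Stable G (V ─ N[_] G x) T → Stable G V (T ∪ ⁅ x ⁆)
  Stable-link⇒Stable x∈V stable@(T⊆ , _) =
    Stable-∪⁅⁆ (Stable-mono (p─q⊆p _ _) stable) x∈V λ z z∈T → ∉N[]⇒nonadj (x∈p─q⇒x∉q _ _ (T⊆ z∈T))

  Stable⇒Stable-link : Stable G V S → x ∈ S → Stable G (V ─ N[_] G x) (S - x)
  Stable⇒Stable-link {V} {S} {x} (S⊆V , indep) x∈S =
    S-x⊆ , λ a b a∈ b∈ → indep a b (p─q⊆p _ _ a∈) (p─q⊆p _ _ b∈)
    where
    S-x⊆ : S - x ⊆ V ─ N[_] G x
    S-x⊆ y∈ = let y∈S = p─q⊆p _ _ y∈ in
      x∈p∧x∉q⇒x∈p─q (S⊆V y∈S) (nonadj⇒∉N[] (indep _ _ x∈S y∈S) (x∈p-y⇒x≢y S y∈))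

  Maximal-link⇒Maximal : x ∈ V → MaximalStable G (V ─ N[_] G x) T → MaximalStable G V (T ∪ ⁅ x ⁆)
  Maximal-link⇒Maximal {x = x} x∈V (stable , maximal) = Stable-link⇒Stable x∈V stable , λ W stableW T∪x⊆W →
    p-x⊆q⇒p⊆q∪⁅x⁆ (maximal (W - x) (Stable⇒Stable-link stableW (T∪x⊆W (q⊆p∪q _ _ (x∈⁅x⁆ x))))
                              (p⊆q∧x∉p⇒p⊆q-x (T∪x⊆W ∘ p⊆p∪q _) (x∉link stable)))

  Maximal⇒Maximal-link : MaximalStable G V S → x ∈ S → MaximalStable G (V ─ N[_] G x) (S - x)
  Maximal⇒Maximal-link (stable , maximal) x∈S = Stable⇒Stable-link stable x∈S , λ T stableT S-x⊆T →
    p⊆q∧x∉p⇒p⊆q-x (maximal _ (Stable-link⇒Stable (proj₁ stable x∈S) stableT) (p-x⊆q⇒p⊆q∪⁅x⁆ S-x⊆T) ∘ p⊆p∪q _)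
                  (x∉link stableT)

  Stable-delete : Stable G V S → x ∉ S → Stable G (V - x) S
  Stable-delete (S⊆V , indep) x∉S = p⊆q∧x∉p⇒p⊆q-x S⊆V x∉S , indep

  Maximal⇒Maximal-delete : MaximalStable G V S → x ∉ S → MaximalStable G (V - x) S
  Maximal⇒Maximal-delete (stable , maximal) x∉S =
    Stable-delete stable x∉S , λ T stableT → maximal T (Stable-mono (p─q⊆p _ _) stableT)

  Maximal-delete⇒Maximal : SheddingIn V x → MaximalStable G (V - x) S → MaximalStable G V S
  Maximal-delete⇒Maximal {V} {x} {S} shedding (stable@(S⊆V-x , indep) , maximal) =
    Stable-mono (p─q⊆p _ _) stable , maximal′
    where
    maximal′ : ∀ T → Stable G V T → S ⊆ T → T ⊆ S
    maximal′ T stableT S⊆T with x ∈? T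
    ... | no x∉T  = maximal T (Stable-delete stableT x∉T) S⊆T
    ... | yes x∈T = contradiction (stable , maximal) (shedding S (S⊆link , indep))
      where
      S⊆link : S ⊆ V ─ N[_] G x
      S⊆link y∈S = let y∈V-x = S⊆V-x y∈S in
        x∈p∧x∉q⇒x∈p─q (p─q⊆p _ _ y∈V-x) (nonadj⇒∉N[] (proj₂ stableT _ _ x∈T (S⊆T y∈S)) (x∈p-y⇒x≢y V y∈V-x))

  -- Shellability of links, cones and shedding decompositions

  record Shelling (V : Subset n) : Set where
    field
      facets     : List (Subset n)
      isShelling : IsShelling facets
      sound      : ∀ {F} → F ∈ₗ facets → MaximalStable G V F
      complete   : ∀ {F} → MaximalStable G V F → F ∈ₗ facets

  Shellable⇒Shelling : Shellable G V → Shelling V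
  Shellable⇒Shelling (s , F , _ , facet , onto , order) = record
    { facets     = reverseTabulate F
    ; isShelling = reverseTabulate-shelling order
    ; sound      = sound
    ; complete   = λ maximal → let i , Fi≡ = onto _ maximal in subst (_∈ₗ _) Fi≡ (∈-reverseTabulate⁺ F i)
    }
    where
    sound : ∀ {E} → E ∈ₗ reverseTabulate F → MaximalStable G _ E
    sound E∈ with i , refl ← ∈-reverseTabulate⁻ F E∈ = facet i

  Shelling⇒Shellable : Shelling V → Shellable G V
  Shelling⇒Shellable shelling =
    length facets , index facets , index-injective isShelling , (λ i → sound (index-∈ facets i)) ,
    (λ _ maximal → ∈⇒index (complete maximal)) , index-order isShelling
    where open Shelling shelling

  Shelling-link : x ∈ V → Shelling V → Shelling (V ─ N[_] G x)
  Shelling-link {x} {V} x∈V shelling = record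
    { facets     = link x facets
    ; isShelling = IsShelling-link x isShelling
    ; sound      = sound′
    ; complete   = λ {T} maximal → subst (_∈ₗ _) (x∉p⇒[p∪⁅x⁆]-x≡p (x∉link (proj₁ maximal)))
        (∈-map∘filter⁺ (_- x) (x ∈?_)
          (T ∪ ⁅ x ⁆ , complete (Maximal-link⇒Maximal x∈V maximal) , refl , q⊆p∪q _ _ (x∈⁅x⁆ x)))
    }
    where
    open Shelling shelling
    sound′ : ∀ {E} → E ∈ₗ link x facets → MaximalStable G (V ─ N[_] G x) E
    sound′ E∈ with F , F∈ , refl , x∈F ← ∈-map∘filter⁻ (_- x) (x ∈?_) E∈ = Maximal⇒Maximal-link (sound F∈) x∈F

  Shelling-isolated : x ∈ V → Anticomplete x V → Shelling (V ─ N[_] G x) → Shelling V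
  Shelling-isolated {x} {V} x∈V x∼V shelling = record
    { facets     = map (_∪ ⁅ x ⁆) facets
    ; isShelling = IsShelling-∪⁅⁆ (x∉link ∘ proj₁ ∘ sound) isShelling
    ; sound      = sound′
    ; complete   = complete′
    }
    where
    open Shelling shelling
    sound′ : ∀ {E} → E ∈ₗ map (_∪ ⁅ x ⁆) facets → MaximalStable G V E
    sound′ E∈ with F , F∈ , refl ← ∈-map⁻ (_∪ ⁅ x ⁆) E∈ = Maximal-link⇒Maximal x∈V (sound F∈)
    complete′ : ∀ {S} → MaximalStable G V S → S ∈ₗ map (_∪ ⁅ x ⁆) facets
    complete′ {S} maximal@((S⊆V , _) , _) = subst (_∈ₗ _) (x∈p⇒[p-x]∪⁅x⁆≡p x∈S)
      (∈-map⁺ (_∪ ⁅ x ⁆) (complete (Maximal⇒Maximal-link maximal x∈S)))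
      where
      x∈S : x ∈ S
      x∈S = MaximalStable-absorbs maximal x∈V λ z z∈S → x∼V z (S⊆V z∈S)

  Shelling-shedding : x ∈ V → SheddingIn V x → Shelling (V - x) → Shelling (V ─ N[_] G x) → Shelling V
  Shelling-shedding {x} {V} x∈V shedding deletion link = record
    { facets     = map (_∪ ⁅ x ⁆) L.facets ++ D.facets
    ; isShelling = IsShelling-cone++ (x∉link ∘ proj₁ ∘ L.sound) (λ E∈ → x∉p-x V ∘ proj₁ (proj₁ (D.sound E∈)))
                     covered L.isShelling D.isShelling
    ; sound      = sound′
    ; complete   = complete′
    }
    where
    module L = Shelling link
    module D = Shelling deletion
    link⊆deletion : V ─ N[_] G x ⊆ V - x
    link⊆deletion = p⊆q∧x∉p⇒p⊆q-x (p─q⊆p _ _) λ x∈ → x∈p─q⇒x∉q _ _ x∈ (x∈N[x] x)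
    covered : ∀ {F} → F ∈ₗ L.facets → ∃ λ M → M ∈ₗ D.facets × F ⊆ M
    covered F∈ with M , maximal , F⊆M ← maximal-extension (Stable-mono link⊆deletion (proj₁ (L.sound F∈)))
      = M , D.complete maximal , F⊆M
    sound′ : ∀ {E} → E ∈ₗ map (_∪ ⁅ x ⁆) L.facets ++ D.facets → MaximalStable G V E
    sound′ E∈ with ∈-++⁻ (map (_∪ ⁅ x ⁆) L.facets) E∈
    ... | inj₂ E∈D = Maximal-delete⇒Maximal shedding (D.sound E∈D)
    ... | inj₁ E∈L with F , F∈ , refl ← ∈-map⁻ (_∪ ⁅ x ⁆) E∈L = Maximal-link⇒Maximal x∈V (L.sound F∈)
    complete′ : ∀ {S} → MaximalStable G V S → S ∈ₗ map (_∪ ⁅ x ⁆) L.facets ++ D.facets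
    complete′ {S} maximal with x ∈? S
    ... | yes x∈S = ∈-++⁺ˡ (subst (_∈ₗ _) (x∈p⇒[p-x]∪⁅x⁆≡p x∈S)
                      (∈-map⁺ (_∪ ⁅ x ⁆) (L.complete (Maximal⇒Maximal-link maximal x∈S))))
    ... | no  x∉S = ∈-++⁺ʳ _ (D.complete (Maximal⇒Maximal-delete maximal x∉S))

  -- Vertices flanked by vertices of degree two

  degree<3⇒neighbours : ∀ {u p q} → ¬ 3 ≤ degree G u → adj G u p ≡ true → adj G u q ≡ true → q ≢ p →
                        ∀ y → adj G u y ≡ true → y ≡ p ⊎ y ≡ q
  degree<3⇒neighbours {u} {p} {q} deg<3 up uq q≢p y uy with y ≟ p | y ≟ q
  ... | yes y≡p | _       = inj₁ y≡p
  ... | no  _   | yes y≡q = inj₂ y≡q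
  ... | no  y≢p | no  y≢q =
    contradiction (three-elements⇒3≤∣p∣ (adj⇒∈N up) (adj⇒∈N uq) (adj⇒∈N uy) q≢p y≢p y≢q) deg<3

  second-neighbour∈ : ∀ {V S x u t} → Stable G (V ─ N[_] G x) S → MaximalStable G (V - x) S →
                      u ∈ V → adj G x u ≡ true → (∀ y → adj G u y ≡ true → y ≡ x ⊎ y ≡ t) → t ∈ S
  second-neighbour∈ {V} {S} {x} {u} {t} stable@(S⊆link , _) maximal u∈V xu N-u with t ∈? S
  ... | yes t∈S = t∈S
  ... | no  t∉S = contradiction (S⊆link u∈S) λ u∈link → x∈p─q⇒x∉q _ _ u∈link (adj⇒∈N[] xu)
    where
    u∼S : Anticomplete u S
    u∼S z z∈S = ¬-not λ uz → [ (λ { refl → x∉link stable z∈S }) , (λ { refl → t∉S z∈S }) ]′ (N-u z uz)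
    u∈S : u ∈ S
    u∈S = MaximalStable-absorbs maximal (x∈p∧x≢y⇒x∈p-y u∈V (adj⇒≢ xu ∘ sym)) u∼S

  module DegreeTwoNeighbours {x a w d b : Fin n}
    (xa : adj G x a ≡ true) (aw : adj G a w ≡ true) (wd : adj G w d ≡ true) (bx : adj G b x ≡ true)
    (N-a : ∀ y → adj G a y ≡ true → y ≡ x ⊎ y ≡ w) (N-b : ∀ y → adj G b y ≡ true → y ≡ x ⊎ y ≡ d)
    (w≢x : w ≢ x) (b≢w : b ≢ w)
    where

    x-shedding : Shedding G x
    x-shedding S stable maximal =
      Stable⇒nonadj stable (second-neighbour∈ stable maximal ∈⊤ xa N-a)
                           (second-neighbour∈ stable maximal ∈⊤ (adj-sym bx) N-b) wd

    a∈⊤-x : a ∈ ⊤ - x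
    a∈⊤-x = x∈p∧x≢y⇒x∈p-y ∈⊤ (adj⇒≢ xa ∘ sym)

    w-shedding : SheddingIn (⊤ - x) w
    w-shedding S stable@(S⊆ , _) maximal =
      x∉p-x ⊤ (p─q⊆p _ _ (S⊆ (second-neighbour∈ stable maximal a∈⊤-x (adj-sym aw) (λ y → swap ∘ N-a y))))

    deletion-of-w : Shelling ⊤ → Shelling (⊤ - x - w)
    deletion-of-w shelling = Shelling-isolated a∈ a∼ (subst Shelling link-of-a (Shelling-link ∈⊤ shelling))
      where
      a∈ : a ∈ ⊤ - x - w
      a∈ = x∈p∧x≢y⇒x∈p-y a∈⊤-x (adj⇒≢ aw)
      a∼ : Anticomplete a (⊤ - x - w)
      a∼ z z∈ = ¬-not λ az → [ (λ { refl → x∉p-x ⊤ (p─q⊆p _ _ z∈) }) , (λ { refl → x∉p-x _ z∈ }) ]′ (N-a z az)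
      link-of-a : ⊤ ─ N[_] G a ≡ ⊤ - x - w ─ N[_] G a
      link-of-a = sym (trans (x∈q⇒[p-x]─q≡p─q (adj⇒∈N[] aw)) (x∈q⇒[p-x]─q≡p─q (adj⇒∈N[] (adj-sym xa))))

    link-of-w : Shelling ⊤ → Shelling (⊤ - x ─ N[_] G w)
    link-of-w shelling =
      Shelling-isolated b∈ b∼ (subst Shelling link-of-b (Shelling-link b∈⊤─N[w] (Shelling-link ∈⊤ shelling)))
      where
      b∉N[w] : b ∉ N[_] G w
      b∉N[w] = nonadj⇒∉N[] (¬-not λ wb → [ w≢x , adj⇒≢ wd ]′ (N-b w (adj-sym wb))) b≢w
      b∈⊤─N[w] : b ∈ ⊤ ─ N[_] G w
      b∈⊤─N[w] = x∈p∧x∉q⇒x∈p─q ∈⊤ b∉N[w]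
      b∈ : b ∈ ⊤ - x ─ N[_] G w
      b∈ = x∈p∧x∉q⇒x∈p─q (x∈p∧x≢y⇒x∈p-y ∈⊤ (adj⇒≢ bx)) b∉N[w]
      b∼ : Anticomplete b (⊤ - x ─ N[_] G w)
      b∼ z z∈ = ¬-not λ bz →
        [ (λ { refl → x∉p-x ⊤ (p─q⊆p _ _ z∈) }) , (λ { refl → x∈p─q⇒x∉q _ _ z∈ (adj⇒∈N[] wd) }) ]′ (N-b z bz)
      link-of-b : ⊤ ─ N[_] G w ─ N[_] G b ≡ ⊤ - x ─ N[_] G w ─ N[_] G b
      link-of-b = begin
        ⊤ ─ N[_] G w ─ N[_] G b      ≡⟨ x∈q⇒[p-x]─q≡p─q (adj⇒∈N[] bx) ⟨
        ⊤ ─ N[_] G w - x ─ N[_] G b  ≡⟨ cong (_─ N[_] G b) (p─q─r≡p─r─q ⊤ ⁅ x ⁆ (N[_] G w)) ⟨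
        ⊤ - x ─ N[_] G w ─ N[_] G b  ∎
        where open ≡-Reasoning

    deletion : Shelling ⊤ → Shelling (⊤ - x)
    deletion shelling =
      Shelling-shedding (x∈p∧x≢y⇒x∈p-y ∈⊤ w≢x) w-shedding (deletion-of-w shelling) (link-of-w shelling)

  -- Basic 5-cycles

  infixl 10 _⁺
  _⁺ : Fin 5 → Fin 5
  i ⁺ = next5 G i

  ⁺⁵≡ : ∀ i → i ⁺ ⁺ ⁺ ⁺ ⁺ ≡ i
  ⁺⁵≡ zero                         = refl
  ⁺⁵≡ (suc zero)                   = refl
  ⁺⁵≡ (suc (suc zero))             = refl
  ⁺⁵≡ (suc (suc (suc zero)))       = refl
  ⁺⁵≡ (suc (suc (suc (suc zero)))) = refl

  ⁺²≢ : ∀ i → i ⁺ ⁺ ≢ i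
  ⁺²≢ zero                         ()
  ⁺²≢ (suc zero)                   ()
  ⁺²≢ (suc (suc zero))             ()
  ⁺²≢ (suc (suc (suc zero)))       ()
  ⁺²≢ (suc (suc (suc (suc zero)))) ()

  ⁺³≢ : ∀ i → i ⁺ ⁺ ⁺ ≢ i
  ⁺³≢ zero                         ()
  ⁺³≢ (suc zero)                   ()
  ⁺³≢ (suc (suc zero))             ()
  ⁺³≢ (suc (suc (suc zero)))       ()
  ⁺³≢ (suc (suc (suc (suc zero)))) ()

  no-two-consecutive⇒flanked : ∀ {P : Fin 5 → Set} → Decidable P → (∀ i → ¬ (P i × P (i ⁺))) →
                               ∃ λ i → ¬ P (i ⁺) × ¬ P (i ⁺ ⁺ ⁺ ⁺)
  no-two-consecutive⇒flanked P? apart with P? (# 0) | P? (# 2)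
  ... | yes p₀ | _      = # 0 , (λ p₁ → apart (# 0) (p₀ , p₁)) , (λ p₄ → apart (# 4) (p₄ , p₀))
  ... | no ¬p₀ | yes p₂ = # 2 , (λ p₃ → apart (# 2) (p₂ , p₃)) , (λ p₁ → apart (# 1) (p₁ , p₂))
  ... | no ¬p₀ | no ¬p₂ = # 1 , ¬p₂ , ¬p₀

  flanked-vertex-splits : ∀ {c} → Cycle5 G c → ∀ i →
                          ¬ 3 ≤ degree G (c (i ⁺)) → ¬ 3 ≤ degree G (c (i ⁺ ⁺ ⁺ ⁺)) →
                          Shedding G (c i) × (Shelling ⊤ → Shelling (⊤ - c i))
  flanked-vertex-splits {c} (c-injective , edge) i a-deg<3 b-deg<3 = x-shedding , deletion
    where
    bx : adj G (c (i ⁺ ⁺ ⁺ ⁺)) (c i) ≡ true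
    bx = subst (λ j → adj G (c (i ⁺ ⁺ ⁺ ⁺)) (c j) ≡ true) (⁺⁵≡ i) (edge (i ⁺ ⁺ ⁺ ⁺))
    open DegreeTwoNeighbours (edge i) (edge (i ⁺)) (edge (i ⁺ ⁺)) bx
      (degree<3⇒neighbours a-deg<3 (adj-sym (edge i)) (edge (i ⁺)) (⁺²≢ i ∘ c-injective))
      (degree<3⇒neighbours b-deg<3 bx (adj-sym (edge (i ⁺ ⁺ ⁺))) (⁺³≢ i ∘ c-injective))
      (⁺²≢ i ∘ c-injective) (⁺²≢ (i ⁺ ⁺) ∘ c-injective)

mainTheorem10 : (n : ℕ) (G : Graph n) → Connected G →
                (c : Fin 5 → Fin n) → Cycle5 G c → Basic5 G c →
                Shellable G ⊤ ⇔
                  Σ (Fin 5) λ i → Shedding G (c i)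
                    × Shellable G (⊤ - c i)
                    × Shellable G (⊤ ─ N[_] G (c i))
mainTheorem10 n G _ c cycle basic = mk⇔ forward backward
  where
  SplitsAt : Fin 5 → Set
  SplitsAt i = Shedding G (c i) × Shellable G (⊤ - c i) × Shellable G (⊤ ─ N[_] G (c i))
  forward : Shellable G ⊤ → Σ (Fin 5) SplitsAt
  forward shellable
    with i , a-deg<3 , b-deg<3 ←
           no-two-consecutive⇒flanked G (λ i → 3 ≤? degree G (c i)) (λ i → basic i _ (proj₂ cycle i))
    with x-shedding , deletion ← flanked-vertex-splits G cycle i a-deg<3 b-deg<3
    = i , x-shedding , Shelling⇒Shellable G (deletion shelling) ,
      Shelling⇒Shellable G (Shelling-link G ∈⊤ shelling)
    where
    shelling : Shelling G ⊤
    shelling = Shellable⇒Shelling G shellable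
  backward : Σ (Fin 5) SplitsAt → Shellable G ⊤
  backward (i , shedding , deletion , link) = Shelling⇒Shellable G
    (Shelling-shedding G ∈⊤ shedding (Shellable⇒Shelling G deletion) (Shellable⇒Shelling G link))
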